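{- Let $G$ and $H$ be connected graphs. If for every vertex $u\in V(G)$ there exists a vertex $v\in V(G)$, $v\neq u$, such that $\mathrm{Pl}_G(u,v)\cup\{u,v\}$ is a clique of even order in $G$, then B wins the gp achievement game on $G\,\square\,H$.
   Context: A general position set of a graph $G$ is a set $S\subseteq V(G)$ such that no three vertices of $S$ lie on a common shortest path of $G$. The gp achievement game on a graph: players A and B alternately select vertices, A first; a selection is legal if the vertex has not been selected before and the set of all vertices selected so far (including it) is a general position set. The game ends when no legal move exists, and the player who selected the last vertex wins; "a player wins the game" means that player has a winning strategy. For vertices $u,v$ of $G$, $\mathrm{Pl}_G(u,v)$ is the set of vertices $y\notin\{u,v\}$ such that $\{u,v,y\}$ is a general position set of $G$. The Cartesian product $G\,\square\,H$ has vertex set $V(G)\times V(H)$, with $(g_1,h_1)$ adjacent to $(g_2,h_2)$ iff either $g_1g_2\in E(G)$ and $h_1=h_2$, or $g_1=g_2$ and $h_1h_2\in E(H)$. -}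

module Defs where

open import Level using (0ℓ)
open import Data.Nat using (ℕ; zero; suc; _≤_)
open import Data.Nat.Divisibility using (_∣_)
open import Data.List using (List; []; _∷_; length; cartesianProduct)
open import Data.List.Membership.Propositional using (_∈_; _∉_)
open import Data.List.Membership.Propositional.Properties using (∈-cartesianProduct⁺)
open import Data.List.Relation.Unary.Unique.Propositional using (Unique)
open import Data.Product using (Σ; ∃; _×_; _,_)
open import Data.Product.Properties using (≡-dec)
open import Data.Sum using (_⊎_; inj₁; inj₂)
open import Data.Empty using (⊥)
open import Function.Bundles using (_⇔_)
open import Relation.Nullary using (¬_; Dec)
open import Relation.Nullary.Decidable using (_×-dec_; _⊎-dec_)
open import Relation.Binary.Definitions using (DecidableEquality)
open import Relation.Binary.PropositionalEquality using (_≡_; _≢_; refl; sym)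

record Graph : Set₁ where
  field
    V        : Set
    Adj      : V → V → Set
    adj-sym  : ∀ {u v} → Adj u v → Adj v u
    adj-irr  : ∀ {u} → ¬ Adj u u
    _≟_      : DecidableEquality V
    adj?     : ∀ u v → Dec (Adj u v)
    vertices : List V            -- finiteness: an enumeration of V
    complete : ∀ v → v ∈ vertices

open Graph public

data Walk (G : Graph) : V G → V G → Set where
  [_]  : (v : V G) → Walk G v v
  step : (u : V G) {w v : V G} → Adj G u w → Walk G w v → Walk G u v

walkLength : ∀ {G a b} → Walk G a b → ℕ
walkLength [ _ ]          = zero
walkLength (step _ _ p)   = suc (walkLength p)

walkVerts : ∀ {G a b} → Walk G a b → List (V G)
walkVerts [ v ]          = v ∷ []
walkVerts (step u _ p)   = u ∷ walkVerts p

IsShortest : ∀ {G a b} → Walk G a b → Set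
IsShortest {G} {a} {b} p = ∀ (q : Walk G a b) → walkLength p ≤ walkLength q

Connected : Graph → Set
Connected G = V G × (∀ u v → Walk G u v)

OnCommonGeodesic : (G : Graph) → V G → V G → V G → Set
OnCommonGeodesic G x y z =
  Σ (V G) λ a → Σ (V G) λ b → Σ (Walk G a b) λ p →
    IsShortest p × x ∈ walkVerts p × y ∈ walkVerts p × z ∈ walkVerts p

-- general position set (a finite set given as a list of its elements)
IsGP : (G : Graph) → List (V G) → Set
IsGP G S = ∀ x y z → x ∈ S → y ∈ S → z ∈ S →
  x ≢ y → y ≢ z → x ≢ z → ¬ OnCommonGeodesic G x y z

Pl : (G : Graph) → V G → V G → V G → Set
Pl G u v y = y ≢ u × y ≢ v × IsGP G (u ∷ v ∷ y ∷ [])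

IsClique : (G : Graph) → List (V G) → Set
IsClique G C = ∀ x y → x ∈ C → y ∈ C → x ≢ y → Adj G x y

PlCliqueEven : (G : Graph) → V G → V G → Set
PlCliqueEven G u v =
  Σ (List (V G)) λ C →
    Unique C
    × (∀ y → y ∈ C ⇔ (y ≡ u ⊎ y ≡ v ⊎ Pl G u v y))
    × IsClique G C
    × 2 ∣ length C

_□_ : Graph → Graph → Graph
G □ H = record
  { V        = V G × V H
  ; Adj      = λ { (g₁ , h₁) (g₂ , h₂) →
                   (Adj G g₁ g₂ × h₁ ≡ h₂) ⊎ (g₁ ≡ g₂ × Adj H h₁ h₂) }
  ; adj-sym  = λ { (inj₁ (a , e)) → inj₁ (adj-sym G a , sym e)
                 ; (inj₂ (e , a)) → inj₂ (sym e , adj-sym H a) }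
  ; adj-irr  = λ { (inj₁ (a , _)) → adj-irr G a
                 ; (inj₂ (_ , a)) → adj-irr H a }
  ; _≟_      = ≡-dec (_≟_ G) (_≟_ H)
  ; adj?     = λ { (g₁ , h₁) (g₂ , h₂) →
                   (adj? G g₁ g₂ ×-dec (_≟_ H h₁ h₂))
                   ⊎-dec (_≟_ G g₁ g₂ ×-dec adj? H h₁ h₂) }
  ; vertices = cartesianProduct (vertices G) (vertices H)
  ; complete = λ { (g , h) → ∈-cartesianProduct⁺ (complete G g) (complete H h) }
  }

-- The gp achievement game
-- A position is the list of vertices selected so far.  A move v is legal
-- if v is new and the selected set together with v is in general position.

Legal : (G : Graph) → List (V G) → V G → Set
Legal G S v = v ∉ S × IsGP G (v ∷ S)

-- Wins G S : the player to move at position S has a winning strategy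
-- Loses G S : the player not to move at S has a winning strategy
-- (normal play: a player with no legal move loses).
mutual
  data Wins (G : Graph) (S : List (V G)) : Set where
    win : (v : V G) → Legal G S v → Loses G (v ∷ S) → Wins G S

  data Loses (G : Graph) (S : List (V G)) : Set where
    lose : (∀ v → Legal G S v → Wins G (v ∷ S)) → Loses G S

-- B (second player) wins the gp achievement game on G
BWins : Graph → Set
BWins G = Loses G []

-- B answers A's opening move (u , h) by (v , h), with v as in the hypothesis for u, and
-- afterwards answers every move (y , k) by its mirror image (μ y , k), where μ is a perfect
-- matching of the even clique C = Pl(u,v) ∪ {u,v} with μ u = v.
-- Three vertices lie on a common geodesic iff one of them is metrically between the other
-- two, and distances in G □ H are sums of the coordinate distances. So every later legal
-- move (y , k) has y ∈ C, for otherwise u, v, y are on a geodesic of G, which lifts to one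
-- through (u , h), (v , h), (y , k). The mirror map is an isometry of C × H, hence the
-- answer creates no geodesic triple with two earlier vertices; and a geodesic triple through
-- both (y , k) and (μ y , k) would force a pair (y , l), (μ y , l) into the position, which
-- is on a geodesic with (y , k). B can therefore always answer, and the game is finite.

module Submission where

open import Defs
open import Data.Empty using (⊥; ⊥-elim)
open import Data.List using (List; []; _∷_; length; filter)
open import Data.List.Membership.Propositional using (_∈_; _∉_)
open import Data.List.Relation.Unary.All.Properties using (All¬⇒¬Any)
import Data.List.Relation.Unary.All as All
open import Data.List.Relation.Unary.AllPairs using (_∷_)
open import Data.List.Relation.Unary.Any using (Any; here; there; any?; satisfied)
import Data.List.Relation.Unary.Any as Any
open import Data.List.Relation.Unary.Unique.Propositional using (Unique)
open import Data.Nat using (ℕ; zero; suc; _+_; _≤_; _<_; z≤n; s≤s)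
open import Data.Nat.Divisibility using (_∣_; divides)
open import Data.Nat.Properties hiding (_≟_)
open import Algebra.Properties.CommutativeSemigroup +-commutativeSemigroup
  using () renaming (interchange to +-interchange)
open import Data.Product using (Σ; _×_; _,_; proj₁; proj₂)
import Data.Product as Prod
open import Data.Sum using (_⊎_; inj₁; inj₂; [_,_]′)
import Data.Sum as Sum
open import Function using (_∘_; id)
open import Function.Bundles using (Equivalence)
open import Relation.Binary.Definitions using (DecidableEquality)
open import Relation.Binary.PropositionalEquality
  using (_≡_; _≢_; refl; sym; trans; cong; cong₂; subst; module ≡-Reasoning)
open import Relation.Nullary using (¬_; Dec; yes; no)
open import Relation.Nullary.Decidable using (_×-dec_; map′)

squeeze : ∀ {x y X Y} → X ≤ x → Y ≤ y → x + y ≤ X + Y → x ≡ X × y ≡ Y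
squeeze {x} {y} {X} {Y} X≤x Y≤y sum≤ =
  ≤-antisym (+-cancelʳ-≤ y x X (≤-trans sum≤ (+-monoʳ-≤ X Y≤y))) X≤x ,
  ≤-antisym (+-cancelˡ-≤ x y Y (≤-trans sum≤ (+-monoˡ-≤ Y X≤x))) Y≤y

-- d is the distance ∣ i - j ∣ of two points of a line, stated without subtraction.
Gap : ℕ → ℕ → ℕ → Set
Gap i j d = i + d ≡ j ⊎ j + d ≡ i

closed-loop : ∀ i x y z → ((i + x) + y) + z ≡ i → x + y ≡ z
closed-loop i x y z loop = trans (m+n≡0⇒m≡0 (x + y) sum≡0) (sym (m+n≡0⇒n≡0 (x + y) sum≡0))
  where
  sum≡0 : (x + y) + z ≡ 0
  sum≡0 = +-cancelˡ-≡ i _ 0 (begin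
    i + ((x + y) + z)  ≡⟨ sym (+-assoc i (x + y) z) ⟩
    (i + (x + y)) + z  ≡⟨ cong (_+ z) (sym (+-assoc i x y)) ⟩
    ((i + x) + y) + z  ≡⟨ loop ⟩
    i                  ≡⟨ sym (+-identityʳ i) ⟩
    i + 0              ∎)
    where open ≡-Reasoning

gaps-collinear : ∀ {i j k A B C} → Gap i j A → Gap j k B → Gap i k C →
  A + C ≡ B ⊎ A + B ≡ C ⊎ C + B ≡ A
gaps-collinear {i} {A = A} {B} {C} (inj₁ refl) (inj₁ refl) (inj₁ e) =
  inj₂ (inj₁ (sym (+-cancelˡ-≡ i C (A + B) (trans e (+-assoc i A B)))))
gaps-collinear {i} {A = A} {B} {C} (inj₁ refl) (inj₁ refl) (inj₂ e) =
  inj₂ (inj₁ (closed-loop i A B C e))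
gaps-collinear {i} {A = A} {B} {C} (inj₁ refl) (inj₂ e) (inj₁ refl) =
  inj₂ (inj₂ (+-cancelˡ-≡ i (C + B) A (trans (sym (+-assoc i C B)) e)))
gaps-collinear {k = k} {A} {B} {C} (inj₁ e) (inj₂ e′) (inj₂ refl) =
  inj₁ (trans (+-comm A C) (+-cancelˡ-≡ k (C + A) B (trans (sym (+-assoc k C A)) (trans e (sym e′)))))
gaps-collinear {j = j} {A = A} {B} {C} (inj₂ refl) (inj₁ refl) (inj₁ e) =
  inj₁ (+-cancelˡ-≡ j (A + C) B (trans (sym (+-assoc j A C)) e))
gaps-collinear {j = j} {A = A} {B} {C} (inj₂ refl) (inj₁ refl) (inj₂ e) =
  inj₂ (inj₂ (trans (+-comm C B) (+-cancelˡ-≡ j (B + C) A (trans (sym (+-assoc j B C)) e))))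
gaps-collinear {k = k} {A} {B} {C} (inj₂ refl) (inj₂ refl) (inj₁ e) =
  inj₂ (inj₁ (trans (+-comm A B) (closed-loop k B A C e)))
gaps-collinear {k = k} {A} {B} {C} (inj₂ refl) (inj₂ refl) (inj₂ e) =
  inj₂ (inj₁ (trans (+-comm A B) (sym (+-cancelˡ-≡ k C (B + A) (trans e (+-assoc k B A))))))

module _ {G : Graph} where

  infixr 5 _++ʷ_

  _++ʷ_ : ∀ {a m b} → Walk G a m → Walk G m b → Walk G a b
  [ _ ]      ++ʷ q = q
  step u e p ++ʷ q = step u e (p ++ʷ q)

  walkLength-++ʷ : ∀ {a m b} (p : Walk G a m) (q : Walk G m b) →
    walkLength (p ++ʷ q) ≡ walkLength p + walkLength q
  walkLength-++ʷ [ _ ]        q = refl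
  walkLength-++ʷ (step u e p) q = cong suc (walkLength-++ʷ p q)

  reverseʷ : ∀ {a b} → Walk G a b → Walk G b a
  reverseʷ [ v ]            = [ v ]
  reverseʷ (step u {w} e p) = reverseʷ p ++ʷ step w (adj-sym G e) [ u ]

  walkLength-reverseʷ : ∀ {a b} (p : Walk G a b) → walkLength (reverseʷ p) ≡ walkLength p
  walkLength-reverseʷ [ v ]            = refl
  walkLength-reverseʷ (step u {w} e p) = begin
    walkLength (reverseʷ p ++ʷ step w (adj-sym G e) [ u ])  ≡⟨ walkLength-++ʷ (reverseʷ p) _ ⟩
    walkLength (reverseʷ p) + 1                            ≡⟨ +-comm _ 1 ⟩
    suc (walkLength (reverseʷ p))                          ≡⟨ cong suc (walkLength-reverseʷ p) ⟩
    suc (walkLength p)                                     ∎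
    where open ≡-Reasoning

  walkLength≡0⇒≡ : ∀ {a b} (p : Walk G a b) → walkLength p ≡ 0 → a ≡ b
  walkLength≡0⇒≡ [ _ ]        _  = refl
  walkLength≡0⇒≡ (step _ _ _) ()

  start∈walkVerts : ∀ {a b} (p : Walk G a b) → a ∈ walkVerts p
  start∈walkVerts [ _ ]        = here refl
  start∈walkVerts (step _ _ _) = here refl

  end∈walkVerts : ∀ {a b} (p : Walk G a b) → b ∈ walkVerts p
  end∈walkVerts [ _ ]        = here refl
  end∈walkVerts (step _ _ p) = there (end∈walkVerts p)

  ∈-++ʷ⁺ˡ : ∀ {a m b z} (p : Walk G a m) (q : Walk G m b) →
    z ∈ walkVerts p → z ∈ walkVerts (p ++ʷ q)
  ∈-++ʷ⁺ˡ [ _ ]        q (here refl) = start∈walkVerts q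
  ∈-++ʷ⁺ˡ (step u e p) q (here refl) = here refl
  ∈-++ʷ⁺ˡ (step u e p) q (there z∈p) = there (∈-++ʷ⁺ˡ p q z∈p)

  ∈-++ʷ⁺ʳ : ∀ {a m b z} (p : Walk G a m) (q : Walk G m b) →
    z ∈ walkVerts q → z ∈ walkVerts (p ++ʷ q)
  ∈-++ʷ⁺ʳ [ _ ]        q z∈q = z∈q
  ∈-++ʷ⁺ʳ (step u e p) q z∈q = there (∈-++ʷ⁺ʳ p q z∈q)

  ∈-++ʷ⁻ : ∀ {a m b z} (p : Walk G a m) (q : Walk G m b) →
    z ∈ walkVerts (p ++ʷ q) → z ∈ walkVerts p ⊎ z ∈ walkVerts q
  ∈-++ʷ⁻ [ _ ]        q z∈q         = inj₂ z∈q
  ∈-++ʷ⁻ (step u e p) q (here refl) = inj₁ (here refl)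
  ∈-++ʷ⁻ (step u e p) q (there z∈)  = Sum.map₁ there (∈-++ʷ⁻ p q z∈)

  splitAt : ∀ {a b m} (p : Walk G a b) → m ∈ walkVerts p →
    Σ (Walk G a m) λ p₁ → Σ (Walk G m b) λ p₂ → p₁ ++ʷ p₂ ≡ p
  splitAt [ v ]        (here refl) = [ v ] , [ v ] , refl
  splitAt (step u e p) (here refl) = [ u ] , step u e p , refl
  splitAt (step u e p) (there m∈p) with splitAt p m∈p
  ... | p₁ , p₂ , refl = step u e p₁ , p₂ , refl

  onCommonGeodesic-swap₁₂ : ∀ {x y z} → OnCommonGeodesic G x y z → OnCommonGeodesic G y x z
  onCommonGeodesic-swap₁₂ (a , b , p , sh , x∈ , y∈ , z∈) = a , b , p , sh , y∈ , x∈ , z∈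

  onCommonGeodesic-swap₂₃ : ∀ {x y z} → OnCommonGeodesic G x y z → OnCommonGeodesic G x z y
  onCommonGeodesic-swap₂₃ (a , b , p , sh , x∈ , y∈ , z∈) = a , b , p , sh , x∈ , z∈ , y∈

  gp-[] : IsGP G []
  gp-[] _ _ _ ()

  gp-∷ : ∀ {x S} → IsGP G S →
    (∀ {a b} → a ∈ S → b ∈ S → x ≢ a → a ≢ b → x ≢ b → ¬ OnCommonGeodesic G x a b) →
    IsGP G (x ∷ S)
  gp-∷ gpS new _ _ _ (here refl) (here refl) _           x≢y _   _   _ = x≢y refl
  gp-∷ gpS new _ _ _ (here refl) (there _)   (here refl) _   _   x≢z _ = x≢z refl
  gp-∷ gpS new _ _ _ (there _)   (here refl) (here refl) _   y≢z _   _ = y≢z refl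
  gp-∷ gpS new _ _ _ (here refl) (there a∈)  (there b∈)  x≢a a≢b x≢b   = new a∈ b∈ x≢a a≢b x≢b
  gp-∷ gpS new _ _ _ (there a∈)  (here refl) (there b∈)  a≢x x≢b a≢b   =
    new a∈ b∈ (a≢x ∘ sym) a≢b x≢b ∘ onCommonGeodesic-swap₁₂
  gp-∷ gpS new _ _ _ (there a∈)  (there b∈)  (here refl) a≢b b≢x a≢x   =
    new a∈ b∈ (a≢x ∘ sym) a≢b (b≢x ∘ sym) ∘ onCommonGeodesic-swap₁₂ ∘ onCommonGeodesic-swap₂₃
  gp-∷ gpS new _ _ _ (there a∈)  (there b∈)  (there c∈)                = gpS _ _ _ a∈ b∈ c∈

  gp-head : ∀ {x S a b} → IsGP G (x ∷ S) → x ∉ S → a ∈ S → b ∈ S → a ≢ b →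
    ¬ OnCommonGeodesic G x a b
  gp-head gp x∉S a∈ b∈ a≢b =
    gp _ _ _ (here refl) (there a∈) (there b∈) (λ { refl → x∉S a∈ }) a≢b (λ { refl → x∉S b∈ })

  gp-pair : ∀ {a b} → IsGP G (a ∷ b ∷ [])
  gp-pair = gp-∷ (gp-∷ gp-[] λ ()) λ where
    (here refl) (here refl) _ b≢b _ _ → b≢b refl
    (there ())  _
    _           (there ())

  gp-triple : ∀ {a b c} → ¬ OnCommonGeodesic G a b c → IsGP G (a ∷ b ∷ c ∷ [])
  gp-triple ¬abc = gp-∷ gp-pair λ where
    (here refl)         (here refl)         _ b≢b _ _ → b≢b refl
    (here refl)         (there (here refl)) _ _   _ → ¬abc
    (there (here refl)) (here refl)         _ _   _ → ¬abc ∘ onCommonGeodesic-swap₂₃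
    (there (here refl)) (there (here refl)) _ c≢c _ _ → c≢c refl
    (there (there ()))  _
    _                   (there (there ()))

-- Distance and betweenness

module Metric (G : Graph) (connected : ∀ a b → Walk G a b) where

  Reachable≤ : ℕ → V G → V G → Set
  Reachable≤ n a b = Σ (Walk G a b) λ p → walkLength p ≤ n

  reachable≤? : ∀ n a b → Dec (Reachable≤ n a b)
  reachable≤? n a b with _≟_ G a b
  ... | yes refl = yes ([ a ] , z≤n)
  reachable≤? zero    a b | no a≢b = no λ { ([ _ ] , _) → a≢b refl ; (step _ _ _ , ()) }
  reachable≤? (suc n) a b | no a≢b =
    map′ viaNeighbour toNeighbour (any? (λ w → adj? G a w ×-dec reachable≤? n w b) (vertices G))
    where
    viaNeighbour : Any (λ w → Adj G a w × Reachable≤ n w b) (vertices G) → Reachable≤ (suc n) a b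
    viaNeighbour via with satisfied via
    ... | _ , e , p , p≤n = step a e p , s≤s p≤n
    toNeighbour : Reachable≤ (suc n) a b → Any (λ w → Adj G a w × Reachable≤ n w b) (vertices G)
    toNeighbour ([ _ ] , _)                = ⊥-elim (a≢b refl)
    toNeighbour (step _ {w} e p , s≤s p≤n) = Any.map (λ { refl → e , p , p≤n }) (complete G w)

  shorten : ∀ {a b} n (p : Walk G a b) → walkLength p ≤ n → Σ (Walk G a b) IsShortest
  shorten         zero    p p≤0 = p , λ q → ≤-trans p≤0 z≤n
  shorten {a} {b} (suc n) p p≤n with reachable≤? n a b
  ... | yes (q , q≤n) = shorten n q q≤n
  ... | no ¬q         = p , λ q → ≤-trans p≤n (≰⇒> (λ q≤n → ¬q (q , q≤n)))

  shortest : ∀ a b → Σ (Walk G a b) IsShortest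
  shortest a b = shorten _ (connected a b) ≤-refl

  geodesic : ∀ a b → Walk G a b
  geodesic a b = proj₁ (shortest a b)

  dist : V G → V G → ℕ
  dist a b = walkLength (geodesic a b)

  dist≤walkLength : ∀ {a b} (p : Walk G a b) → dist a b ≤ walkLength p
  dist≤walkLength {a} {b} = proj₂ (shortest a b)

  IsShortest⇒≡dist : ∀ {a b} (p : Walk G a b) → IsShortest p → walkLength p ≡ dist a b
  IsShortest⇒≡dist {a} {b} p sh = ≤-antisym (sh (geodesic a b)) (dist≤walkLength p)

  ≡dist⇒IsShortest : ∀ {a b} (p : Walk G a b) → walkLength p ≡ dist a b → IsShortest p
  ≡dist⇒IsShortest p p≡ q = ≤-trans (≤-reflexive p≡) (dist≤walkLength q)

  dist-sym : ∀ a b → dist a b ≡ dist b a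
  dist-sym a b = ≤-antisym (dist≤reverse b a) (dist≤reverse a b)
    where
    dist≤reverse : ∀ a b → dist b a ≤ dist a b
    dist≤reverse a b =
      ≤-trans (dist≤walkLength (reverseʷ (geodesic a b))) (≤-reflexive (walkLength-reverseʷ _))

  dist-triangle : ∀ a m b → dist a b ≤ dist a m + dist m b
  dist-triangle a m b = ≤-trans (dist≤walkLength (geodesic a m ++ʷ geodesic m b))
                                (≤-reflexive (walkLength-++ʷ (geodesic a m) (geodesic m b)))

  dist-refl : ∀ a → dist a a ≡ 0
  dist-refl a = n≤0⇒n≡0 (dist≤walkLength [ a ])

  ≢⇒dist≥1 : ∀ {a b} → a ≢ b → 1 ≤ dist a b
  ≢⇒dist≥1 {a} {b} a≢b = n≢0⇒n>0 (a≢b ∘ walkLength≡0⇒≡ (geodesic a b))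

  dist-step : ∀ {a w} b → Adj G a w → dist a b ≤ suc (dist w b)
  dist-step {a} {w} b e = dist≤walkLength (step a e (geodesic w b))

  Adj⇒dist≤1 : ∀ {a b} → Adj G a b → dist a b ≤ 1
  Adj⇒dist≤1 {a} {b} e = dist≤walkLength (step a e [ b ])

  Between : V G → V G → V G → Set
  Between a m b = dist a m + dist m b ≡ dist a b

  Collinear : V G → V G → V G → Set
  Collinear x y z = Between y x z ⊎ Between x y z ⊎ Between x z y

  between-endˡ : ∀ a b → Between a a b
  between-endˡ a b = cong (_+ dist a b) (dist-refl a)

  between-endʳ : ∀ a b → Between a b b
  between-endʳ a b = trans (cong (dist a b +_) (dist-refl b)) (+-identityʳ _)

  between-sym : ∀ {a m b} → Between a m b → Between b m a
  between-sym {a} {m} {b} amb = begin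
    dist b m + dist m a  ≡⟨ cong₂ _+_ (dist-sym b m) (dist-sym m a) ⟩
    dist m b + dist a m  ≡⟨ +-comm (dist m b) _ ⟩
    dist a m + dist m b  ≡⟨ amb ⟩
    dist a b             ≡⟨ dist-sym a b ⟩
    dist b a             ∎
    where open ≡-Reasoning

  between⇒onCommonGeodesic : ∀ {a m b} → Between a m b → OnCommonGeodesic G a m b
  between⇒onCommonGeodesic {a} {m} {b} amb =
    a , b , p₁ ++ʷ p₂ ,
    ≡dist⇒IsShortest (p₁ ++ʷ p₂) (trans (walkLength-++ʷ p₁ p₂) amb) ,
    ∈-++ʷ⁺ˡ p₁ p₂ (start∈walkVerts p₁) ,
    ∈-++ʷ⁺ˡ p₁ p₂ (end∈walkVerts p₁) ,
    ∈-++ʷ⁺ʳ p₁ p₂ (end∈walkVerts p₂)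
    where
    p₁ = geodesic a m
    p₂ = geodesic m b

  collinear⇒onCommonGeodesic : ∀ {x y z} → Collinear x y z → OnCommonGeodesic G x y z
  collinear⇒onCommonGeodesic (inj₁ yxz)        = onCommonGeodesic-swap₁₂ (between⇒onCommonGeodesic yxz)
  collinear⇒onCommonGeodesic (inj₂ (inj₁ xyz)) = between⇒onCommonGeodesic xyz
  collinear⇒onCommonGeodesic (inj₂ (inj₂ xzy)) = onCommonGeodesic-swap₂₃ (between⇒onCommonGeodesic xzy)

  ++ʷ-shortest : ∀ {a m b} (p : Walk G a m) (q : Walk G m b) → IsShortest (p ++ʷ q) →
    IsShortest p × IsShortest q × Between a m b
  ++ʷ-shortest {a} {m} {b} p q sh =
    ≡dist⇒IsShortest p (proj₁ tight) , ≡dist⇒IsShortest q (proj₂ tight) ,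
    trans (sym (cong₂ _+_ (proj₁ tight) (proj₂ tight))) lengths
    where
    lengths : walkLength p + walkLength q ≡ dist a b
    lengths = trans (sym (walkLength-++ʷ p q)) (IsShortest⇒≡dist (p ++ʷ q) sh)
    tight : walkLength p ≡ dist a m × walkLength q ≡ dist m b
    tight = squeeze (dist≤walkLength p) (dist≤walkLength q)
                    (≤-trans (≤-reflexive lengths) (dist-triangle a m b))

  between-on-shortest : ∀ {a b m} (p : Walk G a b) → IsShortest p → m ∈ walkVerts p → Between a m b
  between-on-shortest p sh m∈ with splitAt p m∈
  ... | p₁ , p₂ , refl = proj₂ (proj₂ (++ʷ-shortest p₁ p₂ sh))

  between-split : ∀ {a m n b} → Between a m b → Between m n b → Between a m n
  between-split {a} {m} {n} {b} amb mnb = ≤-antisym (+-cancelʳ-≤ (dist n b) _ _ (begin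
    (dist a m + dist m n) + dist n b  ≡⟨ +-assoc (dist a m) _ _ ⟩
    dist a m + (dist m n + dist n b)  ≡⟨ cong (dist a m +_) mnb ⟩
    dist a m + dist m b               ≡⟨ amb ⟩
    dist a b                          ≤⟨ dist-triangle a n b ⟩
    dist a n + dist n b               ∎)) (dist-triangle a m n)
    where open ≤-Reasoning

  gap-on-shortest : ∀ {a b m n} (p : Walk G a b) → IsShortest p →
    m ∈ walkVerts p → n ∈ walkVerts p → Gap (dist a m) (dist a n) (dist m n)
  gap-on-shortest {a} {n = n} p sh m∈ n∈ with splitAt p m∈
  ... | p₁ , p₂ , refl with ++ʷ-shortest p₁ p₂ sh | ∈-++ʷ⁻ p₁ p₂ n∈
  ... | sh₁ , _ , _ | inj₁ n∈p₁ =
    inj₂ (trans (cong (dist a n +_) (dist-sym _ n)) (between-on-shortest p₁ sh₁ n∈p₁))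
  ... | _ , sh₂ , amb | inj₂ n∈p₂ = inj₁ (between-split amb (between-on-shortest p₂ sh₂ n∈p₂))

  onCommonGeodesic⇒collinear : ∀ {x y z} → OnCommonGeodesic G x y z → Collinear x y z
  onCommonGeodesic⇒collinear {x} {y} {z} (_ , _ , p , sh , x∈ , y∈ , z∈)
    with gaps-collinear (gap-on-shortest p sh x∈ y∈) (gap-on-shortest p sh y∈ z∈)
                        (gap-on-shortest p sh x∈ z∈)
  ... | inj₁ yxz        = inj₁ (trans (cong (_+ dist x z) (dist-sym y x)) yxz)
  ... | inj₂ (inj₁ xyz) = inj₂ (inj₁ xyz)
  ... | inj₂ (inj₂ xzy) = inj₂ (inj₂ (trans (cong (dist x z +_) (dist-sym z y)) xzy))

  between-≤1 : ∀ {a m b} → dist a b ≤ 1 → Between a m b → m ≡ a ⊎ m ≡ b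
  between-≤1 {a} {m} {b} ab≤1 amb with _≟_ G m a | _≟_ G m b
  ... | yes m≡a | _       = inj₁ m≡a
  ... | no _    | yes m≡b = inj₂ m≡b
  ... | no m≢a  | no m≢b  = ⊥-elim (1+n≰n (begin
    2                    ≤⟨ +-mono-≤ (≢⇒dist≥1 (m≢a ∘ sym)) (≢⇒dist≥1 m≢b) ⟩
    dist a m + dist m b  ≡⟨ amb ⟩
    dist a b             ≤⟨ ab≤1 ⟩
    1                    ∎))
    where open ≤-Reasoning

  module _ {C : List (V G)} (clique : IsClique G C) where

    clique-dist≤1 : ∀ {a b} → a ∈ C → b ∈ C → dist a b ≤ 1
    clique-dist≤1 {a} {b} a∈ b∈ with _≟_ G a b
    ... | yes refl = ≤-trans (≤-reflexive (dist-refl a)) z≤n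
    ... | no a≢b   = Adj⇒dist≤1 (clique a b a∈ b∈ a≢b)

    clique-dist : ∀ {a b} → a ∈ C → b ∈ C → a ≢ b → dist a b ≡ 1
    clique-dist a∈ b∈ a≢b = ≤-antisym (clique-dist≤1 a∈ b∈) (≢⇒dist≥1 a≢b)

    clique-isometry : (f : V G → V G) → (∀ {a} → a ∈ C → f a ∈ C) →
      (∀ {a b} → a ∈ C → b ∈ C → f a ≡ f b → a ≡ b) →
      ∀ {a b} → a ∈ C → b ∈ C → dist (f a) (f b) ≡ dist a b
    clique-isometry f f∈ f-inj {a} {b} a∈ b∈ with _≟_ G a b
    ... | yes refl = trans (dist-refl (f a)) (sym (dist-refl a))
    ... | no a≢b   = trans (clique-dist (f∈ a∈) (f∈ b∈) (a≢b ∘ f-inj a∈ b∈))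
                           (sym (clique-dist a∈ b∈ a≢b))

  module _ {D : V G → Set} (f : V G → V G)
           (isometry : ∀ {a b} → D a → D b → dist (f a) (f b) ≡ dist a b) where

    isometry-between : ∀ {a m b} → D a → D m → D b → Between a m b → Between (f a) (f m) (f b)
    isometry-between da dm db amb =
      trans (cong₂ _+_ (isometry da dm) (isometry dm db)) (trans amb (sym (isometry da db)))

    isometry-collinear : ∀ {x y z} → D x → D y → D z → Collinear x y z → Collinear (f x) (f y) (f z)
    isometry-collinear dx dy dz =
      Sum.map (isometry-between dy dx dz)
              (Sum.map (isometry-between dx dy dz) (isometry-between dx dz dy))

module Product (G H : Graph) (connG : ∀ a b → Walk G a b) (connH : ∀ a b → Walk H a b) where

  liftˡ : ∀ {a b} → Walk G a b → (h : V H) → Walk (G □ H) (a , h) (b , h)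
  liftˡ [ a ]        h = [ (a , h) ]
  liftˡ (step a e p) h = step (a , h) (inj₁ (e , refl)) (liftˡ p h)

  liftʳ : ∀ {a b} (g : V G) → Walk H a b → Walk (G □ H) (g , a) (g , b)
  liftʳ g [ a ]        = [ (g , a) ]
  liftʳ g (step a e p) = step (g , a) (inj₂ (refl , e)) (liftʳ g p)

  walkLength-liftˡ : ∀ {a b} (p : Walk G a b) h → walkLength (liftˡ p h) ≡ walkLength p
  walkLength-liftˡ [ _ ]        h = refl
  walkLength-liftˡ (step _ _ p) h = cong suc (walkLength-liftˡ p h)

  walkLength-liftʳ : ∀ {a b} g (p : Walk H a b) → walkLength (liftʳ g p) ≡ walkLength p
  walkLength-liftʳ g [ _ ]        = refl
  walkLength-liftʳ g (step _ _ p) = cong suc (walkLength-liftʳ g p)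

  connected-□ : ∀ x y → Walk (G □ H) x y
  connected-□ (g₁ , h₁) (g₂ , h₂) = liftˡ (connG g₁ g₂) h₁ ++ʷ liftʳ g₂ (connH h₁ h₂)

  module MG = Metric G connG
  module MH = Metric H connH
  module M□ = Metric (G □ H) connected-□

  dist-□-≤ : ∀ {g₁ h₁ g₂ h₂} (q : Walk (G □ H) (g₁ , h₁) (g₂ , h₂)) →
    MG.dist g₁ g₂ + MH.dist h₁ h₂ ≤ walkLength q
  dist-□-≤ {g} {h} [ _ ] = ≤-reflexive (cong₂ _+_ (MG.dist-refl g) (MH.dist-refl h))
  dist-□-≤ {g₁} {h₁} {g₃} {h₃} (step _ {g₂ , _} (inj₁ (e , refl)) q) = begin
    MG.dist g₁ g₃ + MH.dist h₁ h₃        ≤⟨ +-monoˡ-≤ _ (MG.dist-step g₃ e) ⟩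
    suc (MG.dist g₂ g₃ + MH.dist h₁ h₃)  ≤⟨ s≤s (dist-□-≤ q) ⟩
    suc (walkLength q)                   ∎
    where open ≤-Reasoning
  dist-□-≤ {g₁} {h₁} {g₃} {h₃} (step _ {_ , h₂} (inj₂ (refl , e)) q) = begin
    MG.dist g₁ g₃ + MH.dist h₁ h₃        ≤⟨ +-monoʳ-≤ _ (MH.dist-step h₃ e) ⟩
    MG.dist g₁ g₃ + suc (MH.dist h₂ h₃)  ≡⟨ +-suc _ _ ⟩
    suc (MG.dist g₁ g₃ + MH.dist h₂ h₃)  ≤⟨ s≤s (dist-□-≤ q) ⟩
    suc (walkLength q)                   ∎
    where open ≤-Reasoning

  dist-□ : ∀ g₁ h₁ g₂ h₂ → M□.dist (g₁ , h₁) (g₂ , h₂) ≡ MG.dist g₁ g₂ + MH.dist h₁ h₂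
  dist-□ g₁ h₁ g₂ h₂ = ≤-antisym (begin
    M□.dist (g₁ , h₁) (g₂ , h₂)                         ≤⟨ M□.dist≤walkLength (liftˡ p h₁ ++ʷ liftʳ g₂ q) ⟩
    walkLength (liftˡ p h₁ ++ʷ liftʳ g₂ q)              ≡⟨ walkLength-++ʷ (liftˡ p h₁) (liftʳ g₂ q) ⟩
    walkLength (liftˡ p h₁) + walkLength (liftʳ g₂ q)  ≡⟨ cong₂ _+_ (walkLength-liftˡ p h₁) (walkLength-liftʳ g₂ q) ⟩
    MG.dist g₁ g₂ + MH.dist h₁ h₂                       ∎)
    (dist-□-≤ (M□.geodesic (g₁ , h₁) (g₂ , h₂)))
    where
    open ≤-Reasoning
    p = MG.geodesic g₁ g₂
    q = MH.geodesic h₁ h₂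

  between-□⁻ : ∀ {a m b h₁ h₂ h₃} → M□.Between (a , h₁) (m , h₂) (b , h₃) →
    MG.Between a m b × MH.Between h₁ h₂ h₃
  between-□⁻ {a} {m} {b} {h₁} {h₂} {h₃} between =
    squeeze (MG.dist-triangle a m b) (MH.dist-triangle h₁ h₂ h₃) (≤-reflexive (begin
      (MG.dist a m + MG.dist m b) + (MH.dist h₁ h₂ + MH.dist h₂ h₃)  ≡⟨ +-interchange (MG.dist a m) (MG.dist m b) (MH.dist h₁ h₂) _ ⟩
      (MG.dist a m + MH.dist h₁ h₂) + (MG.dist m b + MH.dist h₂ h₃)  ≡⟨ sym (cong₂ _+_ (dist-□ a h₁ m h₂) (dist-□ m h₂ b h₃)) ⟩
      M□.dist (a , h₁) (m , h₂) + M□.dist (m , h₂) (b , h₃)          ≡⟨ between ⟩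
      M□.dist (a , h₁) (b , h₃)                                      ≡⟨ dist-□ a h₁ b h₃ ⟩
      MG.dist a b + MH.dist h₁ h₃                                    ∎))
    where open ≡-Reasoning

  between-□⁺ : ∀ {a m b h₁ h₂ h₃} → MG.Between a m b → MH.Between h₁ h₂ h₃ →
    M□.Between (a , h₁) (m , h₂) (b , h₃)
  between-□⁺ {a} {m} {b} {h₁} {h₂} {h₃} amb h₁h₂h₃ = begin
    M□.dist (a , h₁) (m , h₂) + M□.dist (m , h₂) (b , h₃)          ≡⟨ cong₂ _+_ (dist-□ a h₁ m h₂) (dist-□ m h₂ b h₃) ⟩
    (MG.dist a m + MH.dist h₁ h₂) + (MG.dist m b + MH.dist h₂ h₃)  ≡⟨ +-interchange (MG.dist a m) (MH.dist h₁ h₂) (MG.dist m b) _ ⟩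
    (MG.dist a m + MG.dist m b) + (MH.dist h₁ h₂ + MH.dist h₂ h₃)  ≡⟨ cong₂ _+_ amb h₁h₂h₃ ⟩
    MG.dist a b + MH.dist h₁ h₃                                    ≡⟨ sym (dist-□ a h₁ b h₃) ⟩
    M□.dist (a , h₁) (b , h₃)                                      ∎
    where open ≡-Reasoning

-- Perfect matchings

record PerfectMatching {A : Set} (C : List A) : Set where
  field
    partner            : A → A
    partner-∈          : ∀ {a} → a ∈ C → partner a ∈ C
    partner-≢          : ∀ {a} → a ∈ C → partner a ≢ a
    partner-involutive : ∀ {a} → a ∈ C → partner (partner a) ≡ a

  partner-injective : ∀ {a b} → a ∈ C → b ∈ C → partner a ≡ partner b → a ≡ b
  partner-injective a∈ b∈ e =
    trans (sym (partner-involutive a∈)) (trans (cong partner e) (partner-involutive b∈))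

open PerfectMatching

module _ {A : Set} (_≟ᴬ_ : DecidableEquality A) where

  pairWith : A → A → (A → A) → A → A
  pairWith a b f x with x ≟ᴬ a
  ... | yes _ = b
  ... | no _ with x ≟ᴬ b
  ...   | yes _ = a
  ...   | no _  = f x

  pairWith-first : ∀ a b f → pairWith a b f a ≡ b
  pairWith-first a b f with a ≟ᴬ a
  ... | yes _   = refl
  ... | no a≢a = ⊥-elim (a≢a refl)

  pairWith-second : ∀ a b f → pairWith a b f b ≡ a
  pairWith-second a b f with b ≟ᴬ a
  ... | yes b≡a = b≡a
  ... | no _ with b ≟ᴬ b
  ...   | yes _   = refl
  ...   | no b≢b = ⊥-elim (b≢b refl)

  pairWith-other : ∀ {a b x} f → x ≢ a → x ≢ b → pairWith a b f x ≡ f x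
  pairWith-other {a} {b} {x} f x≢a x≢b with x ≟ᴬ a
  ... | yes x≡a = ⊥-elim (x≢a x≡a)
  ... | no _ with x ≟ᴬ b
  ...   | yes x≡b = ⊥-elim (x≢b x≡b)
  ...   | no _    = refl

  swap : A → A → A → A
  swap a b = pairWith a b id

  swap-involutive : ∀ a b x → swap a b (swap a b x) ≡ x
  swap-involutive a b x with x ≟ᴬ a
  ... | yes refl = pairWith-second x b id
  ... | no x≢a with x ≟ᴬ b
  ...   | yes refl = pairWith-first a x id
  ...   | no x≢b   = pairWith-other id x≢a x≢b

  swap-∈ : ∀ {C a b x} → a ∈ C → b ∈ C → x ∈ C → swap a b x ∈ C
  swap-∈ {a = a} {b} {x} a∈ b∈ x∈ with x ≟ᴬ a
  ... | yes _ = b∈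
  ... | no _ with x ≟ᴬ b
  ...   | yes _ = a∈
  ...   | no _  = x∈

  addPair : ∀ {a b C} → a ≢ b → a ∉ C → b ∉ C → PerfectMatching C → PerfectMatching (a ∷ b ∷ C)
  addPair {a} {b} {C} a≢b a∉C b∉C M = record
    { partner            = μ′
    ; partner-∈          = closed
    ; partner-≢          = fixed-point-free
    ; partner-involutive = involutive
    }
    where
    μ = partner M
    μ′ = pairWith a b μ

    μ′-on-C : ∀ {x} → x ∈ C → μ′ x ≡ μ x
    μ′-on-C x∈ = pairWith-other μ (λ { refl → a∉C x∈ }) (λ { refl → b∉C x∈ })

    closed : ∀ {x} → x ∈ a ∷ b ∷ C → μ′ x ∈ a ∷ b ∷ C
    closed (here refl)         rewrite pairWith-first a b μ  = there (here refl)
    closed (there (here refl)) rewrite pairWith-second a b μ = here refl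
    closed (there (there x∈))  rewrite μ′-on-C x∈            = there (there (partner-∈ M x∈))

    fixed-point-free : ∀ {x} → x ∈ a ∷ b ∷ C → μ′ x ≢ x
    fixed-point-free (here refl)         rewrite pairWith-first a b μ  = a≢b ∘ sym
    fixed-point-free (there (here refl)) rewrite pairWith-second a b μ = a≢b
    fixed-point-free (there (there x∈))  rewrite μ′-on-C x∈            = partner-≢ M x∈

    involutive : ∀ {x} → x ∈ a ∷ b ∷ C → μ′ (μ′ x) ≡ x
    involutive (here refl)         rewrite pairWith-first a b μ  = pairWith-second a b μ
    involutive (there (here refl)) rewrite pairWith-second a b μ = pairWith-first a b μ
    involutive (there (there x∈))  rewrite μ′-on-C x∈ | μ′-on-C (partner-∈ M x∈) =
      partner-involutive M x∈

  pairUp : ∀ C → Unique C → 2 ∣ length C → PerfectMatching C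
  pairUp [] _ _ = record
    { partner = id ; partner-∈ = λ () ; partner-≢ = λ () ; partner-involutive = λ () }
  pairUp (a ∷ [])    _                  (divides zero ())
  pairUp (a ∷ [])    _                  (divides (suc q) ())
  pairUp (a ∷ b ∷ C) _                  (divides zero ())
  pairUp (a ∷ b ∷ C) (a≢ ∷ b≢ ∷ unique) (divides (suc q) eq) =
    addPair (All.head a≢) (All¬⇒¬Any (All.tail a≢)) (All¬⇒¬Any b≢)
            (pairUp C unique (divides q (suc-injective (suc-injective eq))))

  conjugate : ∀ {C} (τ : A → A) → (∀ {a} → a ∈ C → τ a ∈ C) → (∀ a → τ (τ a) ≡ a) →
    PerfectMatching C → PerfectMatching C
  conjugate τ τ-∈ τ-involutive M = record
    { partner            = τ ∘ μ ∘ τ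
    ; partner-∈          = τ-∈ ∘ partner-∈ M ∘ τ-∈
    ; partner-≢          = λ a∈ e → partner-≢ M (τ-∈ a∈) (trans (sym (τ-involutive _)) (cong τ e))
    ; partner-involutive = λ {a} a∈ → begin
        τ (μ (τ (τ (μ (τ a)))))  ≡⟨ cong (τ ∘ μ) (τ-involutive (μ (τ a))) ⟩
        τ (μ (μ (τ a)))          ≡⟨ cong τ (partner-involutive M (τ-∈ a∈)) ⟩
        τ (τ a)                  ≡⟨ τ-involutive a ⟩
        a                        ∎
    }
    where
    open ≡-Reasoning
    μ = partner M

  -- Conjugating by the transposition of v and partner M u makes v the partner of u.
  rematch : ∀ {C u v} (M : PerfectMatching C) → u ∈ C → v ∈ C → v ≢ u →
    Σ (PerfectMatching C) λ M′ → partner M′ u ≡ v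
  rematch {C} {u} {v} M u∈ v∈ v≢u =
    conjugate τ (swap-∈ v∈ (partner-∈ M u∈)) (swap-involutive v w) M , (begin
      τ (partner M (τ u))  ≡⟨ cong (τ ∘ partner M) (pairWith-other id (v≢u ∘ sym) (partner-≢ M u∈ ∘ sym)) ⟩
      τ w                  ≡⟨ pairWith-second v w id ⟩
      v                    ∎)
    where
    open ≡-Reasoning
    w = partner M u
    τ = swap v w

-- Games with an invariant kept by the second player

module _ {A : Set} (_≟ᴬ_ : DecidableEquality A) where
  open import Data.List.Membership.DecPropositional _≟ᴬ_ using (_∈?_; _∉?_)

  unplayed : List A → List A → List A
  unplayed S = filter (_∉? S)

  unplayed-∷-≤ : ∀ x S L → length (unplayed (x ∷ S) L) ≤ length (unplayed S L)
  unplayed-∷-≤ x S []      = z≤n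
  unplayed-∷-≤ x S (y ∷ L) with y ≟ᴬ x | y ∈? S
  ... | yes _ | yes _ = unplayed-∷-≤ x S L
  ... | no _  | yes _ = unplayed-∷-≤ x S L
  ... | yes _ | no _  = m≤n⇒m≤1+n (unplayed-∷-≤ x S L)
  ... | no _  | no _  = s≤s (unplayed-∷-≤ x S L)

  unplayed-∷-< : ∀ {x S L} → x ∈ L → x ∉ S → length (unplayed (x ∷ S) L) < length (unplayed S L)
  unplayed-∷-< {x} {S} {_ ∷ L} (here refl) x∉S with x ≟ᴬ x | x ∈? S
  ... | _      | yes x∈S = ⊥-elim (x∉S x∈S)
  ... | yes _  | no _    = s≤s (unplayed-∷-≤ x S L)
  ... | no x≢x | no _    = ⊥-elim (x≢x refl)
  unplayed-∷-< {x} {S} {y ∷ L} (there x∈L) x∉S with y ≟ᴬ x | y ∈? S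
  ... | yes _ | yes _ = unplayed-∷-< x∈L x∉S
  ... | no _  | yes _ = unplayed-∷-< x∈L x∉S
  ... | yes _ | no _  = m≤n⇒m≤1+n (unplayed-∷-< x∈L x∉S)
  ... | no _  | no _  = s≤s (unplayed-∷-< x∈L x∉S)

module _ (G : Graph) (Invariant : List (V G) → Set)
         (reply : ∀ {S x} → Invariant S → Legal G S x →
                  Σ (V G) λ y → Legal G (x ∷ S) y × Invariant (y ∷ x ∷ S)) where

  private
    remaining : List (V G) → ℕ
    remaining S = length (unplayed (_≟_ G) S (vertices G))

    remaining-< : ∀ {S x} → Legal G S x → remaining (x ∷ S) < remaining S
    remaining-< {x = x} (x∉S , _) = unplayed-∷-< (_≟_ G) (complete G x) x∉S

    loses-within : ∀ n {S} → remaining S ≤ n → Invariant S → Loses G S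
    loses-within zero    S≤0 _ = lose λ _ legal → ⊥-elim (n≮0 (≤-trans (remaining-< legal) S≤0))
    loses-within (suc n) {S} S≤1+n inv = lose respond
      where
      respond : ∀ x → Legal G S x → Wins G (x ∷ S)
      respond x legal with reply inv legal
      ... | y , legal′ , inv′ = win y legal′ (loses-within n bound inv′)
        where
        bound : remaining (y ∷ x ∷ S) ≤ n
        bound = ≤-trans (unplayed-∷-≤ (_≟_ G) y (x ∷ S) (vertices G))
                        (≤-pred (≤-trans (remaining-< legal) S≤1+n))

  invariant⇒Loses : ∀ {S} → Invariant S → Loses G S
  invariant⇒Loses = loses-within _ ≤-refl

-- The mirror strategy

module MirrorStrategy
  (G H : Graph) (connG : ∀ a b → Walk G a b) (connH : ∀ a b → Walk H a b)
  {C : List (V G)} (clique : IsClique G C) (M : PerfectMatching C)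
  {u v : V G} (u∈C : u ∈ C) (partner-u : partner M u ≡ v)
  (Pl⊆C : ∀ {y} → Pl G u v y → y ∈ C) (h : V H) where

  open Product G H connG connH
  open import Data.List.Membership.DecPropositional (_≟_ G) using (_∈?_)

  private
    P = G □ H
    μ = partner M

  v∈C : v ∈ C
  v∈C = subst (_∈ C) partner-u (partner-∈ M u∈C)

  u≢v : u ≢ v
  u≢v u≡v = partner-≢ M u∈C (trans partner-u (sym u≡v))

  OverC : V P → Set
  OverC p = proj₁ p ∈ C

  mirror : V P → V P
  mirror (c , k) = μ c , k

  mirror-involutive : ∀ {p} → OverC p → mirror (mirror p) ≡ p
  mirror-involutive {_ , k} c∈ = cong (_, k) (partner-involutive M c∈)

  mirror-injective : ∀ {p q} → OverC p → OverC q → mirror p ≡ mirror q → p ≡ q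
  mirror-injective p∈ q∈ e =
    trans (sym (mirror-involutive p∈)) (trans (cong mirror e) (mirror-involutive q∈))

  mirror-isometry : ∀ {p q} → OverC p → OverC q → M□.dist (mirror p) (mirror q) ≡ M□.dist p q
  mirror-isometry {a , k} {b , l} a∈ b∈ = begin
    M□.dist (μ a , k) (μ b , l)  ≡⟨ dist-□ (μ a) k (μ b) l ⟩
    MG.dist (μ a) (μ b) + MH.dist k l
      ≡⟨ cong (_+ MH.dist k l) (MG.clique-isometry clique μ (partner-∈ M) (partner-injective M) a∈ b∈) ⟩
    MG.dist a b + MH.dist k l    ≡⟨ sym (dist-□ a k b l) ⟩
    M□.dist (a , k) (b , l)      ∎
    where open ≡-Reasoning

  blocked : ∀ {x S a b} → IsGP P (x ∷ S) → x ∉ S → a ∈ S → b ∈ S → a ≢ b → ¬ M□.Collinear x a b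
  blocked gp x∉S a∈ b∈ a≢b = gp-head gp x∉S a∈ b∈ a≢b ∘ M□.collinear⇒onCommonGeodesic

  move-over-C : ∀ {S x} → (u , h) ∈ S → (v , h) ∈ S → Legal P S x → OverC x
  move-over-C {S} {y , k} u∈S v∈S (x∉S , gp) with y ∈? C
  ... | yes y∈C = y∈C
  ... | no y∉C  = ⊥-elim (y∉C (Pl⊆C (y≢u , y≢v , gp-triple ¬uvy)))
    where
    y≢u : y ≢ u
    y≢u refl = y∉C u∈C
    y≢v : y ≢ v
    y≢v refl = y∉C v∈C
    blocked-by-u,v : ¬ M□.Collinear (y , k) (u , h) (v , h)
    blocked-by-u,v = blocked gp x∉S u∈S v∈S (u≢v ∘ cong proj₁)
    -- With y at an end, the collinearity lifts to (y , k), (u , h), (v , h).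
    ¬uvy : ¬ OnCommonGeodesic G u v y
    ¬uvy ocg with MG.onCommonGeodesic⇒collinear ocg
    ... | inj₁ vuy =
      blocked-by-u,v (inj₂ (inj₁ (between-□⁺ (MG.between-sym vuy) (MH.between-endʳ k h))))
    ... | inj₂ (inj₁ uvy) =
      blocked-by-u,v (inj₂ (inj₂ (between-□⁺ (MG.between-sym uvy) (MH.between-endʳ k h))))
    ... | inj₂ (inj₂ uyv) = [ y≢u , y≢v ]′ (MG.between-≤1 (MG.clique-dist≤1 clique u∈C v∈C) uyv)

  Symmetric : List (V P) → Set
  Symmetric S = ∀ {s} → s ∈ S → OverC s × mirror s ∈ S

  mirror-legal : ∀ {S x} → Symmetric S → OverC x → Legal P S x → Legal P (x ∷ S) (mirror x)
  mirror-legal {S} {y , k} symm y∈C (x∉S , gp) = x′∉ , gp-∷ gp new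
    where
    x = (y , k)
    x′ = mirror x
    μy∈C = partner-∈ M y∈C
    μy≢y = partner-≢ M y∈C

    x′∉ : x′ ∉ x ∷ S
    x′∉ (here x′≡x)  = μy≢y (cong proj₁ x′≡x)
    x′∉ (there x′∈S) = x∉S (subst (_∈ S) (mirror-involutive y∈C) (proj₂ (symm x′∈S)))

    -- (y , l) is between x and (μ y , l), so this pair can never be in the position.
    rung : ∀ {l} → (y , l) ∈ S → (μ y , l) ∈ S → ⊥
    rung {l} y∈ μy∈ = blocked gp x∉S y∈ μy∈ (μy≢y ∘ sym ∘ cong proj₁)
      (inj₂ (inj₁ (between-□⁺ (MG.between-endˡ y (μ y)) (MH.between-endʳ k l))))

    rung-at : ∀ {e l} → (e , l) ∈ S → e ≡ y ⊎ e ≡ μ y → ⊥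
    rung-at s∈ (inj₁ refl) = rung s∈ (proj₂ (symm s∈))
    rung-at s∈ (inj₂ refl) =
      rung (subst (λ c → (c , _) ∈ S) (partner-involutive M y∈C) (proj₂ (symm s∈))) s∈

    -- A clique has no interior points, so s would be (y , l) or (μ y , l).
    x-between : ∀ {s} → s ∈ S → ¬ M□.Between x′ x s
    x-between s∈ x′xs
      with MG.between-≤1 (MG.clique-dist≤1 clique μy∈C (proj₁ (symm s∈))) (proj₁ (between-□⁻ x′xs))
    ... | inj₁ y≡μy = μy≢y (sym y≡μy)
    ... | inj₂ y≡e  = rung-at s∈ (inj₁ (sym y≡e))

    x′-between : ∀ {s} → s ∈ S → ¬ M□.Between x x′ s
    x′-between s∈ xx′s
      with MG.between-≤1 (MG.clique-dist≤1 clique y∈C (proj₁ (symm s∈))) (proj₁ (between-□⁻ xx′s))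
    ... | inj₁ μy≡y = μy≢y μy≡y
    ... | inj₂ μy≡e = rung-at s∈ (inj₂ (sym μy≡e))

    s-between : ∀ {s} → s ∈ S → x′ ≢ s → ¬ M□.Between x′ s x
    s-between s∈ x′≢s x′sx
      with M□.between-≤1 (M□.Adj⇒dist≤1 (inj₁ (clique (μ y) y μy∈C y∈C μy≢y , refl))) x′sx
    ... | inj₁ s≡x′ = x′≢s (sym s≡x′)
    ... | inj₂ s≡x  = x∉S (subst (_∈ S) s≡x s∈)

    new : ∀ {a b} → a ∈ x ∷ S → b ∈ x ∷ S → x′ ≢ a → a ≢ b → x′ ≢ b → ¬ OnCommonGeodesic P x′ a b
    new (here refl) (here refl) _ a≢b _ _ = a≢b refl
    new (here refl) (there b∈) _ _ x′≢b =
      [ x′-between b∈ , [ x-between b∈ , s-between b∈ x′≢b ]′ ]′ ∘ M□.onCommonGeodesic⇒collinear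
    new (there a∈) (here refl) x′≢a _ _ =
      [ x′-between a∈ , [ x-between a∈ , s-between a∈ x′≢a ]′ ]′
        ∘ M□.onCommonGeodesic⇒collinear ∘ onCommonGeodesic-swap₂₃
    new (there a∈) (there b∈) _ a≢b _ =  -- mirror back: x′ ↦ x, isometrically
      blocked gp x∉S (proj₂ (symm a∈)) (proj₂ (symm b∈))
              (a≢b ∘ mirror-injective (proj₁ (symm a∈)) (proj₁ (symm b∈)))
      ∘ subst (λ z → M□.Collinear z (mirror _) (mirror _)) (mirror-involutive y∈C)
      ∘ M□.isometry-collinear mirror mirror-isometry μy∈C (proj₁ (symm a∈)) (proj₁ (symm b∈))
      ∘ M□.onCommonGeodesic⇒collinear

  mirror-symmetric : ∀ {S x} → Symmetric S → OverC x → Symmetric (mirror x ∷ x ∷ S)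
  mirror-symmetric symm x∈ (here refl)         = partner-∈ M x∈ , there (here (mirror-involutive x∈))
  mirror-symmetric symm x∈ (there (here refl)) = x∈ , here refl
  mirror-symmetric symm x∈ (there (there s∈))  = Prod.map₂ (there ∘ there) (symm s∈)

  Invariant : List (V P) → Set
  Invariant S = (u , h) ∈ S × (v , h) ∈ S × Symmetric S

  mirror-reply : ∀ {S x} → Invariant S → Legal P S x →
    Σ (V P) λ y → Legal P (x ∷ S) y × Invariant (y ∷ x ∷ S)
  mirror-reply (u∈S , v∈S , symm) legal =
    mirror _ , mirror-legal symm x∈C legal ,
    there (there u∈S) , there (there v∈S) , mirror-symmetric symm x∈C
    where x∈C = move-over-C u∈S v∈S legal

  opening-reply : Wins P ((u , h) ∷ [])
  opening-reply = win (v , h) (v∉ , gp-pair)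
    (invariant⇒Loses P Invariant mirror-reply (there (here refl) , here refl , symm))
    where
    v∉ : (v , h) ∉ (u , h) ∷ []
    v∉ (here v≡u) = u≢v (sym (cong proj₁ v≡u))
    symm : Symmetric ((v , h) ∷ (u , h) ∷ [])
    symm (here refl)         =
      v∈C , there (here (cong (_, h) (trans (cong μ (sym partner-u)) (partner-involutive M u∈C))))
    symm (there (here refl)) = u∈C , here (cong (_, h) partner-u)

lemma3p4 : (G H : Graph) → Connected G → Connected H →
    (∀ (u : V G) → Σ (V G) λ v → v ≢ u × PlCliqueEven G u v) →
    BWins (G □ H)
lemma3p4 G H (_ , connG) (_ , connH) hyp = lose λ { (u , h) _ → opening-reply u h }
  where
  opening-reply : ∀ u h → Wins (G □ H) ((u , h) ∷ [])
  opening-reply u h with hyp u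
  ... | v , v≢u , C , unique , Pl⇔ , clique , 2∣∣C∣ =
    MirrorStrategy.opening-reply G H connG connH clique M u∈C partner-u Pl⊆C h
    where
    u∈C : u ∈ C
    u∈C = Equivalence.from (Pl⇔ u) (inj₁ refl)
    v∈C : v ∈ C
    v∈C = Equivalence.from (Pl⇔ v) (inj₂ (inj₁ refl))
    Pl⊆C : ∀ {y} → Pl G u v y → y ∈ C
    Pl⊆C y∈Pl = Equivalence.from (Pl⇔ _) (inj₂ (inj₂ y∈Pl))
    matching : Σ (PerfectMatching C) λ M → partner M u ≡ v
    matching = rematch (_≟_ G) (pairUp (_≟_ G) C unique 2∣∣C∣) u∈C v∈C v≢u
    M = proj₁ matching
    partner-u = proj₂ matching
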